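{- The function $I_\theta : \mathbf{Q}_\theta \to \mathbf{Z}$ satisfies, for all $x \in \mathbf{Q}_\theta$: \begin{enumerate} \item $I_\theta(-x) = -I_\theta(x)$; \item $I_\theta(x+2) = I_\theta(x)$; \item if $x \neq 0$, then $I_\theta(x) + I_\theta(1/x) = \mathrm{sign}(x)$. \end{enumerate} Moreover, $I_\theta$ is the unique function $\mathbf{Q}_\theta \to \mathbf{Z}$ satisfying properties (1)--(3).
   Context: $\mathbf{H}$ is the upper half plane. $\mathbf{Q}_\theta$ is the set of rationals $a/c$ with $\gcd(a,c)=1$, $c\ge 1$, $a+c$ odd (it is closed under $x\mapsto -x$, $x \mapsto x+2$, and $x\mapsto 1/x$ for $x\ne 0$). The net $\mathcal{N}_\theta$: for each pair of rationals $a/c$, $b/d$ in lowest terms with $c,d\ge1$, $a,b,c,d$ odd and $ad-bc=\pm2$, take the hyperbolic geodesic joining them, oriented from $a/c$ to $b/d$ if $c<d$, from $b/d$ to $a/c$ if $d<c$, and, if $c=d$ (which happens only when both endpoints are integers), declared doubly oriented. For oriented geodesics $g,h$ in $\mathbf{H}$, define $\varphi_g(h)=0$ if $g\cap h=\emptyset$ or $g$ is doubly oriented; otherwise, at the intersection point let $v$ be the tangent direction of $h$ and $w$ that of $g$, and set $\varphi_g(h)=+1$ if $w$ points to the right of $v$ (i.e. $\det(v,w)<0$ in $\mathbf{R}^2\cong\mathbf{C}$) and $\varphi_g(h)=-1$ if it points to the left. For $x\in\mathbf{Q}_\theta$ let $h_x$ be the oriented geodesic from $i\infty$ to $x$, and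 $I_\theta(x)=\sum_{g\in\mathcal{N}_\theta}\varphi_g(h_x)$ (only finitely many terms are nonzero). $\mathrm{sign}$ is the usual sign function. -}

module Defs where

open import Data.Integer as ℤ using (ℤ; +_; _*_; _+_; _-_; -_; 0ℤ; 1ℤ; _<_; _≤_)
open import Data.Integer.Divisibility using (_∣_)
open import Data.Integer.GCD using (gcd)
open import Data.Rational as ℚ using (ℚ; ↥_; ↧_; 0ℚ)
open import Data.List using (List; map; foldr)
open import Data.List.Relation.Unary.All using (All)
open import Data.List.Relation.Unary.Unique.Propositional using (Unique)
open import Data.List.Membership.Propositional using (_∈_)
open import Data.Product using (Σ; _×_; ∃)
open import Relation.Nullary using (¬_; yes; no)
open import Relation.Binary.PropositionalEquality using (_≡_; _≢_)

Oddℤ : ℤ → Set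
Oddℤ z = ¬ ((+ 2) ∣ z)

-- Q_θ : reduced fractions a/c (c ≥ 1) with a + c odd.
-- (ℚ is stored in lowest terms with positive denominator.)
Qθ : ℚ → Set
Qθ x = Oddℤ ((↥ x) + (↧ x))

sgn : ℚ → ℤ
sgn x with ↥ x
... | ℤ.+[1+ _ ] = 1ℤ
... | + 0        = 0ℤ
... | ℤ.-[1+ _ ] = - 1ℤ

-- A geodesic with rational endpoints a/c and b/d, stored with the left endpoint first.
record Geod : Set where
  constructor geod
  field
    a c b d : ℤ
open Geod public

-- Each geodesic of N_θ (an unordered pair {a/c, b/d}
-- of reduced fractions, c,d ≥ 1, a,b,c,d odd, ad - bc = ±2) is represented by the
-- unique tuple with the smaller endpoint first, i.e. a/c < b/d, i.e. ad - bc = -2.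
InNet : Geod → Set
InNet (geod a c b d) =
  (1ℤ ≤ c) × (1ℤ ≤ d) × (gcd a c ≡ 1ℤ) × (gcd b d ≡ 1ℤ) ×
  Oddℤ a × Oddℤ b × Oddℤ c × Oddℤ d × (a * d - b * c ≡ - (+ 2))

-- φ_g(h_x) for h_x the geodesic from i∞ down to x.
-- h_x (the vertical line Re z = x) meets the semicircle g iff a/c < x < b/d.
-- If c = d, g is doubly oriented: 0.
-- If c < d, g is oriented from its left endpoint a/c to its right endpoint b/d;
--   with v = -i (direction of h_x) and w of positive real part, det(v,w) = Re w > 0,
--   so w points to the left of v: φ = -1.
-- If d < c, g is oriented right-to-left: φ = +1.
φ : Geod → ℚ → ℤ
φ (geod a c b d) x with a * (↧ x) ℤ.<? (↥ x) * c | (↥ x) * d ℤ.<? b * (↧ x)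
... | yes _ | yes _ with c ℤ.≟ d | c ℤ.<? d
...   | yes _ | _     = 0ℤ
...   | no _  | yes _ = - 1ℤ
...   | no _  | no _  = 1ℤ
φ _ x | _ | _ = 0ℤ

sumℤ : List ℤ → ℤ
sumℤ = foldr _+_ 0ℤ

-- "Σ_{g ∈ N_θ} φ_g(h_x) = n": there is a duplicate-free finite list of net geodesics
-- containing every g ∈ N_θ with φ_g(h_x) ≠ 0, and the sum of φ_g(h_x) over it is n.
-- (Any two such lists give the same sum, so this determines n.)
IθSum : ℚ → ℤ → Set
IθSum x n = Σ (List Geod) λ L →
  Unique L × All InNet L ×
  (∀ g → InNet g → φ g x ≢ 0ℤ → g ∈ L) ×
  sumℤ (map (λ g → φ g x) L) ≡ n

-- Properties (1)–(3) for a function f : Q_θ → ℤ (represented as ℚ → ℤ, only its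
-- values on Q_θ being constrained).
Props : (ℚ → ℤ) → Set
Props f =
  (∀ x → Qθ x → f (ℚ.- x) ≡ - f x) ×
  (∀ x → Qθ x → f (x ℚ.+ ℚ.1ℚ ℚ.+ ℚ.1ℚ) ≡ f x) ×
  (∀ x → Qθ x → (nz : x ≢ 0ℚ) →
     f x + f (ℚ.1/_ x {{ℚ.≢-nonZero nz}}) ≡ sgn x)

{-# OPTIONS --safe #-}
module Submission where

-- Write x ∈ Q_θ as p/Q.  The net is invariant under z ↦ -z and z ↦ z + 2, which carry the
-- geodesics crossing h_x to those crossing h_{-x} and h_{x+2}, negating resp. keeping their
-- orientations.  For 0 < x < 1 every net geodesic crossing h_{-1/x} lies left of -1, and
-- z ↦ -1/z carries these to all geodesics crossing h_x except the doubly oriented arc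
-- (-1, 1), while the doubly oriented arc over -1/x becomes one oriented +1; so the sum obeys
-- I_θ(x) = 1 + I_θ(-1/x), which given (1) is (3).  Shifting x by an even integer into (-1, 1) and
-- then passing to -1/x, whose denominator |p| is smaller than Q, is a terminating descent
-- from any x ∈ Q_θ to 0; along it both the sum and any f satisfying (1)–(3) are determined
-- by the same recursion, which gives existence and uniqueness.

open import Defs
open import Data.Integer using (ℤ)
open import Data.Rational using (ℚ)
open import Data.Product using (Σ; _×_)
open import Relation.Binary.PropositionalEquality using (_≡_)

open import Data.Integer as ℤ
  using (+_; -[1+_]; +[1+_]; _+_; _*_; _-_; -_; 0ℤ; 1ℤ; _<_; _≤_; +<+; +≤+; -<+; -<-)
import Data.Integer.Properties as ℤ
open import Data.Integer.DivMod using (_%ℕ_; _/ℕ_; a≡a%ℕn+[a/ℕn]*n; n%ℕd<d)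
import Data.Integer.Divisibility as ℤ
import Data.Integer.Divisibility.Signed as ℤˢ
open import Data.Integer.GCD using (gcd; gcd[i,j]∣i; gcd[i,j]∣j; gcd-greatest; gcd-comm)
open import Data.Integer.Tactic.RingSolver using (solve-∀)
open import Data.Nat as ℕ using (ℕ; zero; suc; s≤s; z≤n)
import Data.Nat.Properties as ℕ
open import Data.Nat.Coprimality using (Coprime; coprime⇒gcd≡1; gcd≡1⇒coprime; 0-coprimeTo-m⇒m≡1)
import Data.Nat.Coprimality as Coprime
import Data.Nat.Divisibility as ℕ
import Data.Nat.GCD as ℕ
open import Data.Rational as ℚ using (mkℚ; ↥_; ↧_; 0ℚ; 1ℚ; toℚᵘ)
import Data.Rational.Properties as ℚ
import Data.Rational.Unnormalised as ℚᵘ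
import Data.Rational.Unnormalised.Properties as ℚᵘ
open import Data.List using (List; []; _∷_; map)
open import Data.List.Properties using (map-∘; map-cong; map-cong-local)
open import Data.List.Membership.Propositional using (_∈_)
open import Data.List.Membership.Propositional.Properties using (∈-map⁺)
open import Data.List.Relation.Unary.All as All using (All; []; _∷_)
open import Data.List.Relation.Unary.All.Properties using (map⁺)
open import Data.List.Relation.Unary.AllPairs using ([]; _∷_)
open import Data.List.Relation.Unary.Any using (here; there)
open import Data.List.Relation.Unary.Unique.Propositional using (Unique)
import Data.List.Relation.Unary.Unique.Propositional.Properties as Unique
open import Data.Product using (_,_; proj₁; proj₂; ∃-syntax)
open import Data.Sum using (_⊎_; inj₁; inj₂)
open import Data.Empty using (⊥-elim)
open import Function using (_∘_)
open import Relation.Nullary using (¬_; yes; no; contradiction)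
open import Relation.Binary.PropositionalEquality using (_≢_; refl; sym; trans; cong; cong₂; subst; subst₂; module ≡-Reasoning)
open import Relation.Binary.Definitions using (tri<; tri≈; tri>)

i<j⇒0<j-i : ∀ {i j} → i < j → 0ℤ < j - i
i<j⇒0<j-i {i} {j} i<j = subst (_< j - i) (ℤ.+-inverseʳ i) (ℤ.+-monoˡ-< (- i) i<j)

0<j-i⇒i<j : ∀ {i j} → 0ℤ < j - i → i < j
0<j-i⇒i<j {i} {j} 0<j-i = subst₂ _<_ (ℤ.+-identityˡ i) (j-i+i≡j i j) (ℤ.+-monoˡ-< i 0<j-i)
  where
  j-i+i≡j : ∀ i j → j - i + i ≡ j
  j-i+i≡j = solve-∀

pos+pos⇒pos : ∀ {i j} → 0ℤ < i → 0ℤ < j → 0ℤ < i + j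
pos+pos⇒pos = ℤ.+-mono-<

pos+nonNeg⇒pos : ∀ {i j} → 0ℤ < i → 0ℤ ≤ j → 0ℤ < i + j
pos+nonNeg⇒pos = ℤ.+-mono-<-≤

nonNeg+pos⇒pos : ∀ {i j} → 0ℤ ≤ i → 0ℤ < j → 0ℤ < i + j
nonNeg+pos⇒pos = ℤ.+-mono-≤-<

nonNeg+nonNeg⇒nonNeg : ∀ {i j} → 0ℤ ≤ i → 0ℤ ≤ j → 0ℤ ≤ i + j
nonNeg+nonNeg⇒nonNeg = ℤ.+-mono-≤

pos*pos⇒pos : ∀ {i j} → 0ℤ < i → 0ℤ < j → 0ℤ < i * j
pos*pos⇒pos (+<+ (s≤s _)) (+<+ (s≤s _)) = +<+ (s≤s z≤n)

nonNeg*nonNeg⇒nonNeg : ∀ {i j} → 0ℤ ≤ i → 0ℤ ≤ j → 0ℤ ≤ i * j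
nonNeg*nonNeg⇒nonNeg {+ m} {+ n} (+≤+ _) (+≤+ _) = subst (0ℤ ≤_) (ℤ.pos-* m n) (+≤+ z≤n)

0<i*j⇒0<j : ∀ {i j} → 0ℤ < i → 0ℤ < i * j → 0ℤ < j
0<i*j⇒0<j {i} {j} 0<i 0<ij = ℤ.*-cancelˡ-<-nonNeg i {{ℤ.nonNegative (ℤ.<⇒≤ 0<i)}}
  (subst (_< i * j) (sym (ℤ.*-zeroʳ i)) 0<ij)

0<i*j⇒0<i : ∀ {i j} → 0ℤ < j → 0ℤ < i * j → 0ℤ < i
0<i*j⇒0<i {i} {j} 0<j 0<ij = 0<i*j⇒0<j 0<j (subst (0ℤ <_) (ℤ.*-comm i j) 0<ij)

1≤i⇒0<i : ∀ {i} → 1ℤ ≤ i → 0ℤ < i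
1≤i⇒0<i = ℤ.<-≤-trans (+<+ (s≤s z≤n))

1≤i⇒0≤i : ∀ {i} → 1ℤ ≤ i → 0ℤ ≤ i
1≤i⇒0≤i = ℤ.<⇒≤ ∘ 1≤i⇒0<i

0<i⇒1≤i : ∀ {i} → 0ℤ < i → 1ℤ ≤ i
0<i⇒1≤i (+<+ (s≤s _)) = +≤+ (s≤s z≤n)

i<0⇒1≤-i : ∀ {i} → i < 0ℤ → 1ℤ ≤ - i
i<0⇒1≤-i -<+ = +≤+ (s≤s z≤n)

0<-i⇒i<0 : ∀ i → 0ℤ < - i → i < 0ℤ
0<-i⇒i<0 i = ℤ.neg-cancel-< {0ℤ} {i}

i*j<0⇒i<0 : ∀ {i j} → 0ℤ < j → i * j < 0ℤ → i < 0ℤ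
i*j<0⇒i<0 {i} {j} 0<j ij<0 = 0<-i⇒i<0 i (0<i*j⇒0<i 0<j (subst (0ℤ <_) (ℤ.neg-distribˡ-* i j) (ℤ.neg-mono-< ij<0)))

i+j≤0⇒i<0 : ∀ {i j} → 0ℤ < j → i + j ≤ 0ℤ → i < 0ℤ
i+j≤0⇒i<0 {i} {j} 0<j i+j≤0 =
  ℤ.<-≤-trans (subst (_< i + j) (ℤ.+-identityʳ i) (ℤ.+-monoʳ-< i 0<j)) i+j≤0

i≡-i⇒i≡0 : ∀ {i} → i ≡ - i → i ≡ 0ℤ
i≡-i⇒i≡0 {+ 0}      _  = refl
i≡-i⇒i≡0 {+[1+ _ ]} ()
i≡-i⇒i≡0 { -[1+ _ ]} ()

a+b≡c⇒a≡c-b : ∀ {a b c} → a + b ≡ c → a ≡ c - b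
a+b≡c⇒a≡c-b {a} {b} a+b≡c = trans (sym (a+b-b≡a a b)) (cong (_- b) a+b≡c)
  where
  a+b-b≡a : ∀ a b → a + b - b ≡ a
  a+b-b≡a = solve-∀

2∣2*k : ∀ k → + 2 ℤ.∣ + 2 * k
2∣2*k k = ℤˢ.∣⇒∣ᵤ (ℤˢ.divides k (ℤ.*-comm (+ 2) k))

odd-+-even : ∀ i k → Oddℤ i → Oddℤ (i + + 2 * k)
odd-+-even i k odd 2∣i+2k =
  odd (ℤˢ.∣⇒∣ᵤ (ℤˢ.∣m+n∣n⇒∣m {+ 2} {i} (ℤˢ.∣ᵤ⇒∣ 2∣i+2k) (ℤˢ.∣ᵤ⇒∣ (2∣2*k k))))

odd-neg : ∀ i → Oddℤ i → Oddℤ (- i)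
odd-neg i odd 2∣-i = odd (subst (2 ℕ.∣_) (ℤ.∣-i∣≡∣i∣ i) 2∣-i)

odd⇒≢0 : ∀ i → Oddℤ i → i ≢ 0ℤ
odd⇒≢0 _ odd refl = odd (ℕ.divides 0 refl)

odd-1 : Oddℤ 1ℤ
odd-1 2∣1 with ℕ.∣1⇒≡1 2∣1
... | ()

odd⇒2k+1 : ∀ i → Oddℤ i → ∃[ k ] i ≡ + 2 * k + 1ℤ
odd⇒2k+1 i odd with i %ℕ 2 | n%ℕd<d i 2 | a≡a%ℕn+[a/ℕn]*n i 2
... | 0 | _ | i≡ = ⊥-elim (odd (subst (+ 2 ℤ.∣_) (sym (trans i≡ (0+t*2 (i /ℕ 2)))) (2∣2*k (i /ℕ 2))))
  where
  0+t*2 : ∀ t → 0ℤ + t * + 2 ≡ + 2 * t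
  0+t*2 = solve-∀
... | 1 | _ | i≡ = i /ℕ 2 , trans i≡ (1+t*2 (i /ℕ 2))
  where
  1+t*2 : ∀ t → 1ℤ + t * + 2 ≡ + 2 * t + 1ℤ
  1+t*2 = solve-∀
... | suc (suc _) | s≤s (s≤s ()) | _

odd+odd⇒even : ∀ i j → Oddℤ i → Oddℤ j → ∃[ k ] i + j ≡ + 2 * k
odd+odd⇒even i j odd-i odd-j with odd⇒2k+1 i odd-i | odd⇒2k+1 j odd-j
... | k , i≡ | l , j≡ = k + l + 1ℤ , trans (cong₂ _+_ i≡ j≡) (sum≡ k l)
  where
  sum≡ : ∀ k l → (+ 2 * k + 1ℤ) + (+ 2 * l + 1ℤ) ≡ + 2 * (k + l + 1ℤ)
  sum≡ = solve-∀

¬odd[i+i] : ∀ i → ¬ Oddℤ (i + i)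
¬odd[i+i] i odd = odd (subst (+ 2 ℤ.∣_) (2i≡i+i i) (2∣2*k i))
  where
  2i≡i+i : ∀ i → + 2 * i ≡ i + i
  2i≡i+i = solve-∀

odd+odd-pos⇒≥2 : ∀ i j → Oddℤ i → Oddℤ j → 0ℤ < i + j → + 2 ≤ i + j
odd+odd-pos⇒≥2 i j odd-i odd-j 0<i+j with odd+odd⇒even i j odd-i odd-j
... | k , i+j≡2k = subst (+ 2 ≤_) (sym i+j≡2k) (2k-pos⇒≥2 k (subst (0ℤ <_) i+j≡2k 0<i+j))
  where
  2k-pos⇒≥2 : ∀ k → 0ℤ < + 2 * k → + 2 ≤ + 2 * k
  2k-pos⇒≥2 +[1+ n ] _ = ℤ.*-monoˡ-≤-nonNeg (+ 2) (+≤+ (s≤s z≤n))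
  2k-pos⇒≥2 (+ 0) (+<+ ())

odd⇒neg⊎pos : ∀ i → Oddℤ i → i < 0ℤ ⊎ 0ℤ < i
odd⇒neg⊎pos i odd with ℤ.<-cmp i 0ℤ
... | tri< i<0 _ _ = inj₁ i<0
... | tri≈ _ i≡0 _ = ⊥-elim (odd⇒≢0 i odd i≡0)
... | tri> _ _ 0<i = inj₂ 0<i

odd-+-comm : ∀ i j → Oddℤ (i + j) → Oddℤ (j + i)
odd-+-comm i j = subst Oddℤ (ℤ.+-comm i j)

odd-+-neg : ∀ i j → Oddℤ (i + j) → Oddℤ (i - j)
odd-+-neg i j odd = subst Oddℤ (i+j-2j≡i-j i j) (odd-+-even (i + j) (- j) odd)
  where
  i+j-2j≡i-j : ∀ i j → i + j + + 2 * - j ≡ i - j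
  i+j-2j≡i-j = solve-∀

odd-translate : ∀ p k Q → Oddℤ (p + Q) → Oddℤ (p + + 2 * k * Q + Q)
odd-translate p k Q odd = subst Oddℤ (reassoc p k Q) (odd-+-even (p + Q) (k * Q) odd)
  where
  reassoc : ∀ p k Q → p + Q + + 2 * (k * Q) ≡ p + + 2 * k * Q + Q
  reassoc = solve-∀

odd-negate : ∀ p Q → Oddℤ (p + Q) → Oddℤ (- p + Q)
odd-negate p Q odd = odd-+-comm Q (- p) (odd-+-neg Q p (odd-+-comm p Q odd))

odd-invert⁺ : ∀ m q → Oddℤ (+[1+ m ] + +[1+ q ]) → Oddℤ (-[1+ q ] + +[1+ m ])
odd-invert⁺ m q odd = odd-+-comm +[1+ m ] -[1+ q ] (odd-+-neg +[1+ m ] +[1+ q ] odd)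

odd-invert⁻ : ∀ m q → Oddℤ (-[1+ m ] + +[1+ q ]) → Oddℤ (+[1+ q ] + +[1+ m ])
odd-invert⁻ m q odd = odd-+-comm +[1+ m ] +[1+ q ] (odd-negate -[1+ m ] +[1+ q ] odd)

gcd[-i,j]≡gcd[i,j] : ∀ i j → gcd (- i) j ≡ gcd i j
gcd[-i,j]≡gcd[i,j] i j = cong (λ n → + ℕ.gcd n ℤ.∣ j ∣) (ℤ.∣-i∣≡∣i∣ i)

gcd[i,-j]≡gcd[i,j] : ∀ i j → gcd i (- j) ≡ gcd i j
gcd[i,-j]≡gcd[i,j] i j = cong (λ n → + ℕ.gcd ℤ.∣ i ∣ n) (ℤ.∣-i∣≡∣i∣ j)

gcd[i+k*j,j]≡gcd[i,j] : ∀ i j k → gcd (i + k * j) j ≡ gcd i j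
gcd[i+k*j,j]≡gcd[i,j] i j k = cong +_ (ℕ.∣-antisym G∣G′ G′∣G)
  where
  G G′ : ℤ
  G = gcd (i + k * j) j
  G′ = gcd i j
  k*j-divisible : ∀ {D} → D ℤ.∣ j → D ℤˢ.∣ k * j
  k*j-divisible {D} D∣j = ℤˢ.∣n⇒∣m*n k (ℤˢ.∣ᵤ⇒∣ {D} {j} D∣j)
  G∣i : G ℤ.∣ i
  G∣i = ℤˢ.∣⇒∣ᵤ {G} {i} (ℤˢ.∣m+n∣n⇒∣m {G} {i} (ℤˢ.∣ᵤ⇒∣ (gcd[i,j]∣i (i + k * j) j))
                                     (k*j-divisible (gcd[i,j]∣j (i + k * j) j)))
  G′∣i+k*j : G′ ℤ.∣ i + k * j
  G′∣i+k*j = ℤˢ.∣⇒∣ᵤ {G′} {i + k * j}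
    (ℤˢ.∣m∣n⇒∣m+n (ℤˢ.∣ᵤ⇒∣ {G′} {i} (gcd[i,j]∣i i j)) (k*j-divisible (gcd[i,j]∣j i j)))
  G∣G′ : G ℤ.∣ G′
  G∣G′ = gcd-greatest {i} {j} {G} G∣i (gcd[i,j]∣j (i + k * j) j)
  G′∣G : G′ ℤ.∣ G
  G′∣G = gcd-greatest {i + k * j} {j} {G′} G′∣i+k*j (gcd[i,j]∣j i j)

coprime-+-* : ∀ p q k → Coprime ℤ.∣ p ∣ (suc q) → Coprime ℤ.∣ p + k * +[1+ q ] ∣ (suc q)
coprime-+-* p q k coprime =
  gcd≡1⇒coprime (trans (cong ℤ.∣_∣ (gcd[i+k*j,j]≡gcd[i,j] p +[1+ q ] k)) (coprime⇒gcd≡1 coprime))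

translate-cancel : ∀ p k Q → p + + 2 * k * Q + + 2 * (- k) * Q ≡ p
translate-cancel = solve-∀

coprime-untranslate : ∀ p q k → Coprime ℤ.∣ p + + 2 * k * +[1+ q ] ∣ (suc q) → Coprime ℤ.∣ p ∣ (suc q)
coprime-untranslate p q k coprime = subst (λ z → Coprime ℤ.∣ z ∣ (suc q)) (translate-cancel p k +[1+ q ])
  (coprime-+-* (p + + 2 * k * +[1+ q ]) q (+ 2 * - k) coprime)

-- Geodesics, crossings and orientation

unitArc : Geod
unitArc = geod (- 1ℤ) 1ℤ 1ℤ 1ℤ

unitArc-InNet : InNet unitArc
unitArc-InNet = +≤+ (s≤s z≤n) , +≤+ (s≤s z≤n) , refl , refl , odd-neg 1ℤ odd-1 , odd-1 , odd-1 , odd-1 , refl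

Crosses : Geod → ℤ → ℤ → Set
Crosses g p Q = a g * Q < p * c g × p * d g < b g * Q

orient : ℤ → ℤ → ℤ
orient i j with i ℤ.≟ j | i ℤ.<? j
... | yes _ | _     = 0ℤ
... | no _  | yes _ = - 1ℤ
... | no _  | no _  = 1ℤ

orientation : Geod → ℤ
orientation g = orient (c g) (d g)

orient-≡ : ∀ {i j} → i ≡ j → orient i j ≡ 0ℤ
orient-≡ {i} {j} i≡j with i ℤ.≟ j | i ℤ.<? j
... | yes _   | _ = refl
... | no i≢j  | _ = contradiction i≡j i≢j

orient-< : ∀ {i j} → i < j → orient i j ≡ - 1ℤ
orient-< {i} {j} i<j with i ℤ.≟ j | i ℤ.<? j
... | yes i≡j | _      = contradiction i≡j (ℤ.<⇒≢ i<j)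
... | no _    | yes _  = refl
... | no _    | no i≮j = contradiction i<j i≮j

orient-> : ∀ {i j} → j < i → orient i j ≡ 1ℤ
orient-> {i} {j} j<i with i ℤ.≟ j | i ℤ.<? j
... | yes i≡j | _      = contradiction (sym i≡j) (ℤ.<⇒≢ j<i)
... | no _    | yes i<j = contradiction i<j (ℤ.<-asym j<i)
... | no _    | no _   = refl

orient-swap : ∀ i j → orient j i ≡ - orient i j
orient-swap i j with ℤ.<-cmp i j
... | tri< i<j _ _ = trans (orient-> i<j) (cong -_ (sym (orient-< i<j)))
... | tri≈ _ i≡j _ = trans (orient-≡ (sym i≡j)) (cong -_ (sym (orient-≡ i≡j)))
... | tri> _ _ j<i = trans (orient-< j<i) (cong -_ (sym (orient-> j<i)))

orient≢0⇒≢ : ∀ {i j} → orient i j ≢ 0ℤ → i ≢ j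
orient≢0⇒≢ orient≢0 i≡j = orient≢0 (orient-≡ i≡j)

≢⇒orient≢0 : ∀ {i j} → i ≢ j → orient i j ≢ 0ℤ
≢⇒orient≢0 {i} {j} i≢j with ℤ.<-cmp i j
... | tri< i<j _ _ = subst (_≢ 0ℤ) (sym (orient-< i<j)) (λ ())
... | tri≈ _ i≡j _ = contradiction i≡j i≢j
... | tri> _ _ j<i = subst (_≢ 0ℤ) (sym (orient-> j<i)) (λ ())

φ≡orientation : ∀ g x → Crosses g (↥ x) (↧ x) → φ g x ≡ orientation g
φ≡orientation (geod a c b d) x (left , right)
  with a * ↧ x ℤ.<? ↥ x * c | ↥ x * d ℤ.<? b * ↧ x
... | no ¬left | _         = contradiction left ¬left
... | yes _    | no ¬right = contradiction right ¬right
... | yes _    | yes _ with c ℤ.≟ d | c ℤ.<? d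
...   | yes _ | yes _ = refl
...   | yes _ | no _  = refl
...   | no _  | yes _ = refl
...   | no _  | no _  = refl

φ≢0⇒Crosses : ∀ g x → φ g x ≢ 0ℤ → Crosses g (↥ x) (↧ x)
φ≢0⇒Crosses (geod a c b d) x φ≢0
  with a * ↧ x ℤ.<? ↥ x * c | ↥ x * d ℤ.<? b * ↧ x
... | yes left | yes right = left , right
... | no _     | _         = contradiction refl φ≢0
... | yes _    | no _      = contradiction refl φ≢0

-- The Möbius maps z ↦ -z, z ↦ z + 2k and z ↦ -1/z acting on the endpoints a/c < b/d.

reflect : Geod → Geod
reflect g = geod (- b g) (d g) (- a g) (c g)

translate : ℤ → Geod → Geod
translate k g = geod (a g + + 2 * k * c g) (c g) (b g + + 2 * k * d g) (d g)

invert : Geod → Geod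
invert g = geod (c g) (- a g) (d g) (- b g)

invert⁻¹ : Geod → Geod
invert⁻¹ g = geod (- c g) (a g) (- d g) (b g)

reflect-involutive : ∀ g → reflect (reflect g) ≡ g
reflect-involutive (geod a c b d) =
  cong₂ (λ a′ b′ → geod a′ c b′ d) (ℤ.neg-involutive a) (ℤ.neg-involutive b)

reflect-injective : ∀ {g h} → reflect g ≡ reflect h → g ≡ h
reflect-injective {g} {h} eq =
  trans (sym (reflect-involutive g)) (trans (cong reflect eq) (reflect-involutive h))

translate-inverseˡ : ∀ k g → translate (- k) (translate k g) ≡ g
translate-inverseˡ k (geod a c b d) = cong₂ (λ a′ b′ → geod a′ c b′ d) (cancel a c k) (cancel b d k)
  where
  cancel : ∀ x y k → x + + 2 * k * y + + 2 * (- k) * y ≡ x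
  cancel = solve-∀

translate-inverseʳ : ∀ k g → translate k (translate (- k) g) ≡ g
translate-inverseʳ k (geod a c b d) = cong₂ (λ a′ b′ → geod a′ c b′ d) (cancel a c k) (cancel b d k)
  where
  cancel : ∀ x y k → x + + 2 * (- k) * y + + 2 * k * y ≡ x
  cancel = solve-∀

translate-injective : ∀ k {g h} → translate k g ≡ translate k h → g ≡ h
translate-injective k {g} {h} eq =
  trans (sym (translate-inverseˡ k g)) (trans (cong (translate (- k)) eq) (translate-inverseˡ k h))

invert-injective : ∀ {g h} → invert g ≡ invert h → g ≡ h
invert-injective {geod a c b d} {geod a′ c′ b′ d′} eq
  with ℤ.neg-injective (cong Geod.c eq) | cong Geod.a eq | ℤ.neg-injective (cong Geod.d eq) | cong Geod.b eq
... | refl | refl | refl | refl = refl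

invert-invert⁻¹ : ∀ g → invert (invert⁻¹ g) ≡ g
invert-invert⁻¹ (geod a c b d) = cong₂ (λ c′ d′ → geod a c′ b d′) (ℤ.neg-involutive c) (ℤ.neg-involutive d)

reflect-InNet : ∀ g → InNet g → InNet (reflect g)
reflect-InNet (geod a c b d) (1≤c , 1≤d , gcd-ac , gcd-bd , odd-a , odd-b , odd-c , odd-d , det) =
  1≤d , 1≤c , trans (gcd[-i,j]≡gcd[i,j] b d) gcd-bd , trans (gcd[-i,j]≡gcd[i,j] a c) gcd-ac ,
  odd-neg b odd-b , odd-neg a odd-a , odd-d , odd-c , trans (same-det a b c d) det
  where
  same-det : ∀ a b c d → (- b) * c - (- a) * d ≡ a * d - b * c
  same-det = solve-∀

translate-InNet : ∀ k g → InNet g → InNet (translate k g)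
translate-InNet k (geod a c b d) (1≤c , 1≤d , gcd-ac , gcd-bd , odd-a , odd-b , odd-c , odd-d , det) =
  1≤c , 1≤d , trans (gcd[i+k*j,j]≡gcd[i,j] a c (+ 2 * k)) gcd-ac , trans (gcd[i+k*j,j]≡gcd[i,j] b d (+ 2 * k)) gcd-bd ,
  odd-+2k* a c odd-a , odd-+2k* b d odd-b , odd-c , odd-d , trans (same-det a b c d k) det
  where
  same-det : ∀ a b c d k → (a + + 2 * k * c) * d - (b + + 2 * k * d) * c ≡ a * d - b * c
  same-det = solve-∀
  odd-+2k* : ∀ x y → Oddℤ x → Oddℤ (x + + 2 * k * y)
  odd-+2k* x y odd = subst Oddℤ (assoc x y k) (odd-+-even x (k * y) odd)
    where
    assoc : ∀ x y k → x + + 2 * (k * y) ≡ x + + 2 * k * y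
    assoc = solve-∀

invert-InNet : ∀ g → InNet g → a g < 0ℤ → b g < 0ℤ → InNet (invert g)
invert-InNet (geod a c b d) (_ , _ , gcd-ac , gcd-bd , odd-a , odd-b , odd-c , odd-d , det) a<0 b<0 =
  i<0⇒1≤-i a<0 , i<0⇒1≤-i b<0 , trans (gcd[i,-j]≡gcd[i,j] c a) (trans (gcd-comm c a) gcd-ac) ,
  trans (gcd[i,-j]≡gcd[i,j] d b) (trans (gcd-comm d b) gcd-bd) ,
  odd-c , odd-d , odd-neg a odd-a , odd-neg b odd-b , trans (same-det a b c d) det
  where
  same-det : ∀ a b c d → c * (- b) - d * (- a) ≡ a * d - b * c
  same-det = solve-∀

invert⁻¹-InNet : ∀ g → InNet g → 0ℤ < a g → 0ℤ < b g → InNet (invert⁻¹ g)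
invert⁻¹-InNet (geod a c b d) (_ , _ , gcd-ac , gcd-bd , odd-a , odd-b , odd-c , odd-d , det) 0<a 0<b =
  0<i⇒1≤i 0<a , 0<i⇒1≤i 0<b , trans (gcd[-i,j]≡gcd[i,j] c a) (trans (gcd-comm c a) gcd-ac) ,
  trans (gcd[-i,j]≡gcd[i,j] d b) (trans (gcd-comm d b) gcd-bd) ,
  odd-neg c odd-c , odd-neg d odd-d , odd-a , odd-b , trans (same-det a b c d) det
  where
  same-det : ∀ a b c d → (- c) * b - (- d) * a ≡ a * d - b * c
  same-det = solve-∀

-[-i*j]≡j*i : ∀ i j → - ((- i) * j) ≡ j * i
-[-i*j]≡j*i = solve-∀

-[i*j]≡j*-i : ∀ i j → - (i * j) ≡ j * (- i)
-[i*j]≡j*-i = solve-∀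

-[i*j]≡-j*i : ∀ i j → - (i * j) ≡ (- j) * i
-[i*j]≡-j*i = solve-∀

reflect-Crosses : ∀ g {p Q} → Crosses g p Q → Crosses (reflect g) (- p) Q
reflect-Crosses g {p} {Q} (left , right) =
  subst₂ _<_ (ℤ.neg-distribˡ-* (b g) Q) (ℤ.neg-distribˡ-* p (d g)) (ℤ.neg-mono-< right) ,
  subst₂ _<_ (ℤ.neg-distribˡ-* p (c g)) (ℤ.neg-distribˡ-* (a g) Q) (ℤ.neg-mono-< left)

translate-Crosses : ∀ k g {p Q} → Crosses g p Q → Crosses (translate k g) (p + + 2 * k * Q) Q
translate-Crosses k g {p} {Q} (left , right) =
  subst₂ _<_ (shiftˡ (a g) (c g) Q k) (shiftʳ p (c g) Q k) (ℤ.+-monoˡ-< (+ 2 * k * Q * c g) left) ,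
  subst₂ _<_ (shiftʳ p (d g) Q k) (shiftˡ (b g) (d g) Q k) (ℤ.+-monoˡ-< (+ 2 * k * Q * d g) right)
  where
  shiftˡ : ∀ x y Q k → x * Q + + 2 * k * Q * y ≡ (x + + 2 * k * y) * Q
  shiftˡ = solve-∀
  shiftʳ : ∀ x y Q k → x * y + + 2 * k * Q * y ≡ (x + + 2 * k * Q) * y
  shiftʳ = solve-∀

invert-Crosses : ∀ g {Q M} → Crosses g (- Q) M → Crosses (invert g) M Q
invert-Crosses g {Q} {M} (left , right) =
  subst₂ _<_ (-[-i*j]≡j*i Q (c g)) (-[i*j]≡j*-i (a g) M) (ℤ.neg-mono-< left) ,
  subst₂ _<_ (-[i*j]≡j*-i (b g) M) (-[-i*j]≡j*i Q (d g)) (ℤ.neg-mono-< right)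

invert⁻¹-Crosses : ∀ g {Q M} → Crosses g M Q → Crosses (invert⁻¹ g) (- Q) M
invert⁻¹-Crosses g {Q} {M} (left , right) =
  subst₂ _<_ (-[i*j]≡-j*i M (c g)) (-[i*j]≡-j*i (a g) Q) (ℤ.neg-mono-< left) ,
  subst₂ _<_ (-[i*j]≡-j*i (b g) Q) (-[i*j]≡-j*i M (d g)) (ℤ.neg-mono-< right)

-- ad - bc = -2 with a ≤ -1 and b, c, d ≥ 1 forces (-a)d = bc = 1.
straddling-0⇒unitArc : ∀ g → InNet g → a g < 0ℤ → 0ℤ < b g → g ≡ unitArc
straddling-0⇒unitArc (geod -[1+ α ] +[1+ γ ] +[1+ β ] +[1+ δ ])
  (+≤+ (s≤s _) , +≤+ (s≤s _) , _ , _ , _ , _ , _ , _ , det) -<+ (+<+ (s≤s _))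
  with unit-det α β γ δ det
  where
  unit-det : ∀ α β γ δ → -[1+ α ] * +[1+ δ ] - +[1+ β ] * +[1+ γ ] ≡ - + 2 →
             α ≡ 0 × β ≡ 0 × γ ≡ 0 × δ ≡ 0
  unit-det α β γ (suc δ) ()
  unit-det (suc α) β γ 0 ()
  unit-det 0 β (suc γ) 0 ()
  unit-det 0 (suc β) 0 0 ()
  unit-det 0 0 0 0 refl = refl , refl , refl , refl
... | refl , refl , refl , refl = refl

crossing-below-−1 : ∀ g {Q M} → 0ℤ < c g → 0ℤ < M → M < Q → Crosses g (- Q) M → a g + c g < 0ℤ
crossing-below-−1 g {Q} {M} 0<c 0<M M<Q (left , _) =
  0<-i⇒i<0 (a g + c g) (0<i*j⇒0<j 0<M (subst (0ℤ <_) (identity (a g) (c g) Q M) 0<sum))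
  where
  0<sum : 0ℤ < ((- Q) * c g - a g * M) + (Q - M) * c g
  0<sum = pos+pos⇒pos (i<j⇒0<j-i left) (pos*pos⇒pos (i<j⇒0<j-i M<Q) 0<c)
  identity : ∀ a c Q M → ((- Q) * c - a * M) + (Q - M) * c ≡ M * - (a + c)
  identity = solve-∀

-- Otherwise -c - a ≥ 2 and b + d ≥ 2 by parity, and bc - ad = (-c - a)d + (b + d)c ≥ 4.
net-avoids-−1 : ∀ g → InNet g → a g + c g < 0ℤ → b g + d g ≤ 0ℤ
net-avoids-−1 g (1≤c , 1≤d , _ , _ , odd-a , odd-b , odd-c , odd-d , det) a+c<0 =
  ℤ.≮⇒≥ (λ 0<b+d → 4≰2 (4≤2 0<b+d))
  where
  open ℤ.≤-Reasoning
  4≰2 : ¬ (+ 4 ≤ + 2)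
  4≰2 (+≤+ (s≤s (s≤s ())))
  -[a+c]≡-c-a : ∀ a c → - (a + c) ≡ - c - a
  -[a+c]≡-c-a = solve-∀
  2≤-c-a : + 2 ≤ - c g - a g
  2≤-c-a = odd+odd-pos⇒≥2 (- c g) (- a g) (odd-neg (c g) odd-c) (odd-neg (a g) odd-a)
             (subst (0ℤ <_) (-[a+c]≡-c-a (a g) (c g)) (ℤ.neg-mono-< a+c<0))
  ≡-det : ∀ a b c d → (- c - a) * d + (b + d) * c ≡ - (a * d - b * c)
  ≡-det = solve-∀
  4≤2 : 0ℤ < b g + d g → + 4 ≤ + 2
  4≤2 0<b+d = begin
    + 4                                     ≤⟨ ℤ.+-mono-≤ (ℤ.*-monoˡ-≤-nonNeg (+ 2) 1≤d) (ℤ.*-monoˡ-≤-nonNeg (+ 2) 1≤c) ⟩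
    + 2 * d g + + 2 * c g                   ≤⟨ ℤ.+-mono-≤ (ℤ.*-monoʳ-≤-nonNeg (d g) {{ℤ.nonNegative (1≤i⇒0≤i 1≤d)}} 2≤-c-a)
                                                          (ℤ.*-monoʳ-≤-nonNeg (c g) {{ℤ.nonNegative (1≤i⇒0≤i 1≤c)}}
                                                            (odd+odd-pos⇒≥2 (b g) (d g) odd-b odd-d 0<b+d)) ⟩
    (- c g - a g) * d g + (b g + d g) * c g ≡⟨ ≡-det (a g) (b g) (c g) (d g) ⟩
    - (a g * d g - b g * c g)               ≡⟨ cong -_ det ⟩
    + 2                                     ∎

left-of-−1 : ∀ g {Q M} → InNet g → 0ℤ < M → M < Q → Crosses g (- Q) M → a g < 0ℤ × b g + d g ≤ 0ℤ
left-of-−1 g net@(1≤c , _) 0<M M<Q cr =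
  i+j≤0⇒i<0 {a g} {c g} (1≤i⇒0<i 1≤c) (ℤ.<⇒≤ a+c<0) , net-avoids-−1 g net a+c<0
  where
  a+c<0 : a g + c g < 0ℤ
  a+c<0 = crossing-below-−1 g (1≤i⇒0<i 1≤c) 0<M M<Q cr

orientation-invert-doubly : ∀ g → InNet g → c g ≡ d g → orientation (invert g) ≡ 1ℤ
orientation-invert-doubly g (1≤c , _ , _ , _ , _ , _ , _ , _ , det) c≡d =
  orient-> { - a g} { - b g} (ℤ.neg-mono-< (0<j-i⇒i<j {a g} {b g} (0<i*j⇒0<j (1≤i⇒0<i 1≤c) 0<c*[b-a])))
  where
  ≡-det : ∀ a b c → - (a * c - b * c) ≡ c * (b - a)
  ≡-det = solve-∀
  0<c*[b-a] : 0ℤ < c g * (b g - a g)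
  0<c*[b-a] = subst (0ℤ <_) (trans (cong (λ e → - (a g * e - b g * c g)) (sym c≡d)) (≡-det (a g) (b g) (c g)))
                (subst (0ℤ <_) (cong -_ (sym det)) (+<+ (s≤s z≤n)))

-- d(a - b) = (-b - d)(d - c) + (d + 2)(d - c - 2) + 2c + 2, with d - c ≥ 2 by parity.
c<d⇒b<a : ∀ g → InNet g → b g + d g ≤ 0ℤ → c g < d g → b g < a g
c<d⇒b<a g (1≤c , 1≤d , _ , _ , _ , _ , odd-c , odd-d , det) b+d≤0 c<d =
  0<j-i⇒i<j (0<i*j⇒0<j (1≤i⇒0<i 1≤d)
    (subst (0ℤ <_) (trans (identity (a g) (b g) (c g) (d g))
                          (trans (cong (λ e → d g * (a g - b g) - (e + + 2)) det) (ℤ.+-identityʳ _)))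
           0<certificate))
  where
  0≤-b-d : 0ℤ ≤ - b g - d g
  0≤-b-d = subst (0ℤ ≤_) (ℤ.neg-distrib-+ (b g) (d g)) (ℤ.neg-mono-≤ b+d≤0)
  0≤d-c-2 : 0ℤ ≤ d g - c g - + 2
  0≤d-c-2 = ℤ.i≤j⇒0≤j-i (odd+odd-pos⇒≥2 (d g) (- c g) odd-d (odd-neg (c g) odd-c) (i<j⇒0<j-i c<d))
  0<certificate : 0ℤ < (- b g - d g) * (d g - c g) + (d g + + 2) * (d g - c g - + 2) + + 2 * c g + + 2
  0<certificate = nonNeg+pos⇒pos
    (nonNeg+nonNeg⇒nonNeg
      (nonNeg+nonNeg⇒nonNeg (nonNeg*nonNeg⇒nonNeg 0≤-b-d (ℤ.<⇒≤ (i<j⇒0<j-i c<d)))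
                            (nonNeg*nonNeg⇒nonNeg (nonNeg+nonNeg⇒nonNeg (1≤i⇒0≤i 1≤d) (+≤+ z≤n)) 0≤d-c-2))
      (nonNeg*nonNeg⇒nonNeg {+ 2} {c g} (+≤+ z≤n) (1≤i⇒0≤i 1≤c)))
    (+<+ (s≤s z≤n))
  identity : ∀ a b c d → (- b - d) * (d - c) + (d + + 2) * (d - c - + 2) + + 2 * c + + 2 ≡
                         d * (a - b) - (a * d - b * c + + 2)
  identity = solve-∀

-- d(b - a) = (-b)(c - d) + 2.
d<c⇒a<b : ∀ g → InNet g → b g + d g ≤ 0ℤ → d g < c g → a g < b g
d<c⇒a<b g (_ , 1≤d , _ , _ , _ , _ , _ , _ , det) b+d≤0 d<c =
  0<j-i⇒i<j (0<i*j⇒0<j (1≤i⇒0<i 1≤d)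
    (subst (0ℤ <_) (trans (identity (a g) (b g) (c g) (d g))
                          (trans (cong (λ e → d g * (b g - a g) + (e + + 2)) det) (ℤ.+-identityʳ _)))
           0<certificate))
  where
  0<certificate : 0ℤ < (- b g) * (c g - d g) + + 2
  0<certificate = pos+pos⇒pos (pos*pos⇒pos (ℤ.neg-mono-< (i+j≤0⇒i<0 {b g} {d g} (1≤i⇒0<i 1≤d) b+d≤0))
                                           (i<j⇒0<j-i d<c))
                              (+<+ (s≤s z≤n))
  identity : ∀ a b c d → (- b) * (c - d) + + 2 ≡ d * (b - a) + (a * d - b * c + + 2)
  identity = solve-∀

orientation-invert : ∀ g → InNet g → b g + d g ≤ 0ℤ → c g ≢ d g → orientation (invert g) ≡ orientation g
orientation-invert g net b+d≤0 c≢d with ℤ.<-cmp (c g) (d g)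
... | tri< c<d _ _ = trans (orient-< { - a g} { - b g} (ℤ.neg-mono-< (c<d⇒b<a g net b+d≤0 c<d))) (sym (orient-< c<d))
... | tri≈ _ c≡d _ = contradiction c≡d c≢d
... | tri> _ _ d<c = trans (orient-> { - a g} { - b g} (ℤ.neg-mono-< (d<c⇒a<b g net b+d≤0 d<c))) (sym (orient-> d<c))

unitArc≢invert : ∀ g → 1ℤ ≤ c g → unitArc ≢ invert g
unitArc≢invert g 1≤c eq with subst (1ℤ ≤_) (cong Geod.a (sym eq)) 1≤c
... | ()

sumℤ-map-neg : ∀ xs → sumℤ (map -_ xs) ≡ - sumℤ xs
sumℤ-map-neg []       = refl
sumℤ-map-neg (x ∷ xs) = trans (cong (_+_ (- x)) (sumℤ-map-neg xs)) (sym (ℤ.neg-distrib-+ x (sumℤ xs)))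

Complete : ℤ → ℤ → List Geod → Set
Complete p Q L = ∀ g → InNet g → Crosses g p Q → g ∈ L

-- The net geodesics crossing h_{p/(1+q)}, the doubly oriented one (the arc between
-- the two odd integers around p/(1+q)) listed first.
record Crossings (p : ℤ) (q : ℕ) (v : ℤ) : Set where
  field
    top             : Geod
    others          : List Geod
    top-doubly      : c top ≡ d top
    others-oriented : All (λ g → c g ≢ d g) others
    unique          : Unique (top ∷ others)
    inNet           : All InNet (top ∷ others)
    crossing        : All (λ g → Crosses g p +[1+ q ]) (top ∷ others)
    complete        : Complete p +[1+ q ] (top ∷ others)
    sum             : sumℤ (map orientation (top ∷ others)) ≡ v

open Crossings

crossings-zero : ∀ q → Crossings 0ℤ q 0ℤ
crossings-zero q = record
  { top = unitArc ; others = [] ; top-doubly = refl ; others-oriented = []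
  ; unique = [] ∷ [] ; inNet = unitArc-InNet ∷ [] ; crossing = (-<+ , +<+ (s≤s z≤n)) ∷ []
  ; complete = λ g net (left , right) → here (straddling-0⇒unitArc g net
      (i*j<0⇒i<0 (+<+ (s≤s z≤n)) (subst (a g * +[1+ q ] <_) (ℤ.*-zeroˡ (c g)) left))
      (0<i*j⇒0<i (+<+ (s≤s z≤n)) (subst (_< b g * +[1+ q ]) (ℤ.*-zeroˡ (d g)) right)))
  ; sum = refl
  }

crossings-reflect : ∀ {p q v} → Crossings p q v → Crossings (- p) q (- v)
crossings-reflect {p} {q} {v} C = record
  { top = reflect (top C)
  ; others = map reflect (others C)
  ; top-doubly = sym (top-doubly C)
  ; others-oriented = map⁺ (All.map (λ {g} c≢d → c≢d ∘ sym) (others-oriented C))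
  ; unique = Unique.map⁺ reflect-injective (unique C)
  ; inNet = map⁺ (All.map (λ {g} → reflect-InNet g) (inNet C))
  ; crossing = map⁺ (All.map (λ {g} → reflect-Crosses g {p} {+[1+ q ]}) (crossing C))
  ; complete = λ g net cr → subst (_∈ map reflect L) (reflect-involutive g)
      (∈-map⁺ reflect (complete C (reflect g) (reflect-InNet g net)
        (subst (λ p′ → Crosses (reflect g) p′ +[1+ q ]) (ℤ.neg-involutive p) (reflect-Crosses g { - p} {+[1+ q ]} cr))))
  ; sum = begin
      sumℤ (map orientation (map reflect L))  ≡⟨ cong sumℤ (sym (map-∘ {g = orientation} {f = reflect} L)) ⟩
      sumℤ (map (orientation ∘ reflect) L)    ≡⟨ cong sumℤ (map-cong (λ g → orient-swap (c g) (d g)) L) ⟩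
      sumℤ (map (-_ ∘ orientation) L)         ≡⟨ cong sumℤ (map-∘ {g = -_} {f = orientation} L) ⟩
      sumℤ (map -_ (map orientation L))       ≡⟨ sumℤ-map-neg (map orientation L) ⟩
      - sumℤ (map orientation L)              ≡⟨ cong -_ (sum C) ⟩
      - v                                     ∎
  }
  where
  open ≡-Reasoning
  L : List Geod
  L = top C ∷ others C

crossings-translate : ∀ {p q v} k → Crossings p q v → Crossings (p + + 2 * k * +[1+ q ]) q v
crossings-translate {p} {q} {v} k C = record
  { top = translate k (top C)
  ; others = map (translate k) (others C)
  ; top-doubly = top-doubly C
  ; others-oriented = map⁺ {P = λ g → c g ≢ d g} (others-oriented C)
  ; unique = Unique.map⁺ (translate-injective k) (unique C)
  ; inNet = map⁺ (All.map (λ {g} → translate-InNet k g) (inNet C))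
  ; crossing = map⁺ (All.map (λ {g} → translate-Crosses k g {p} {+[1+ q ]}) (crossing C))
  ; complete = λ g net cr → subst (_∈ map (translate k) L) (translate-inverseʳ k g)
      (∈-map⁺ (translate k) (complete C (translate (- k) g) (translate-InNet (- k) g net)
        (subst (λ p′ → Crosses (translate (- k) g) p′ +[1+ q ]) (translate-cancel p k +[1+ q ])
               (translate-Crosses (- k) g {p + + 2 * k * +[1+ q ]} {+[1+ q ]} cr))))
  ; sum = trans (cong sumℤ (sym (map-∘ {g = orientation} {f = translate k} L))) (sum C)
  }
  where
  L : List Geod
  L = top C ∷ others C

Crosses⇒0<b : ∀ g {M Q} → 0ℤ < M → 0ℤ < Q → 1ℤ ≤ d g → Crosses g M Q → 0ℤ < b g
Crosses⇒0<b g 0<M 0<Q 1≤d (_ , right) = 0<i*j⇒0<i 0<Q (ℤ.<-trans (pos*pos⇒pos 0<M (1≤i⇒0<i 1≤d)) right)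

invert-Complete : ∀ {m q L} → m ℕ.< q → Complete -[1+ q ] +[1+ m ] L →
                  Complete +[1+ m ] +[1+ q ] (unitArc ∷ map invert L)
invert-Complete {m} {q} {L} m<q complete g net@(_ , 1≤d , _ , _ , odd-a , _) cr
  with odd⇒neg⊎pos (a g) odd-a | Crosses⇒0<b g {+[1+ m ]} {+[1+ q ]} (+<+ (s≤s z≤n)) (+<+ (s≤s z≤n)) 1≤d cr
... | inj₁ a<0 | 0<b = here (straddling-0⇒unitArc g net a<0 0<b)
... | inj₂ 0<a | 0<b = there (subst (_∈ map invert L) (invert-invert⁻¹ g)
      (∈-map⁺ invert (complete (invert⁻¹ g) (invert⁻¹-InNet g net 0<a 0<b)
                                            (invert⁻¹-Crosses g {+[1+ q ]} {+[1+ m ]} cr))))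

crossings-invert : ∀ {m q v} → m ℕ.< q → Crossings -[1+ q ] m v → Crossings +[1+ m ] q (1ℤ + v)
crossings-invert {m} {q} {v} m<q C = record
  { top = unitArc
  ; others = map invert (top C ∷ others C)
  ; top-doubly = refl
  ; others-oriented = map⁺ (orient≢0⇒≢ (subst (_≢ 0ℤ) (sym top-orientation) (λ ()))
      ∷ All.zipWith (λ {g} (eq , c≢d) → orient≢0⇒≢ (subst (_≢ 0ℤ) (sym eq) (≢⇒orient≢0 c≢d)))
                    (others-orientation , others-oriented C))
  ; unique = map⁺ (All.map (λ {g} (1≤c , _) → unitArc≢invert g 1≤c) (inNet C))
      ∷ Unique.map⁺ invert-injective (unique C)
  ; inNet = unitArc-InNet ∷ map⁺ (All.zipWith (λ {g} (net , cr) → invert-InNet′ {g} net cr) (inNet C , crossing C))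
  ; crossing = (-<+ , subst₂ _<_ (sym (ℤ.*-identityʳ M)) (sym (ℤ.*-identityˡ Q)) M<Q)
      ∷ map⁺ (All.map (λ {g} → invert-Crosses g {Q} {M}) (crossing C))
  ; complete = invert-Complete m<q (complete C)
  ; sum = begin
      0ℤ + (orientation (invert (top C)) + S (map invert (others C)))  ≡⟨ ℤ.+-identityˡ _ ⟩
      orientation (invert (top C)) + S (map invert (others C))         ≡⟨ cong₂ _+_ top-orientation others-sum ⟩
      1ℤ + S (others C)                                                 ≡⟨ cong (_+_ 1ℤ) others-sum≡v ⟩
      1ℤ + v                                                            ∎
  }
  where
  open ≡-Reasoning
  Q M : ℤ
  Q = +[1+ q ]
  M = +[1+ m ]
  S : List Geod → ℤ
  S gs = sumℤ (map orientation gs)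
  M<Q : M < Q
  M<Q = +<+ (s≤s m<q)
  b+d≤0 : ∀ {g} → InNet g → Crosses g (- Q) M → b g + d g ≤ 0ℤ
  b+d≤0 {g} net cr = proj₂ (left-of-−1 g net (+<+ (s≤s z≤n)) M<Q cr)
  invert-InNet′ : ∀ {g} → InNet g → Crosses g (- Q) M → InNet (invert g)
  invert-InNet′ {g} net@(_ , 1≤d , _) cr =
    invert-InNet g net (proj₁ (left-of-−1 g net (+<+ (s≤s z≤n)) M<Q cr))
                       (i+j≤0⇒i<0 {b g} {d g} (1≤i⇒0<i 1≤d) (b+d≤0 {g} net cr))
  top-orientation : orientation (invert (top C)) ≡ 1ℤ
  top-orientation = orientation-invert-doubly (top C) (All.head (inNet C)) (top-doubly C)
  others-sum≡v : S (others C) ≡ v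
  others-sum≡v = trans (sym (ℤ.+-identityˡ (S (others C))))
                       (trans (cong (_+ S (others C)) (sym (orient-≡ (top-doubly C)))) (sum C))
  others-orientation : All (λ g → orientation (invert g) ≡ orientation g) (others C)
  others-orientation =
    All.zipWith (λ {g} ((net , cr) , c≢d) → orientation-invert g net (b+d≤0 {g} net cr) c≢d)
                (All.zip (All.tail (inNet C) , All.tail (crossing C)) , others-oriented C)
  others-sum : S (map invert (others C)) ≡ S (others C)
  others-sum = cong sumℤ (trans (sym (map-∘ {g = orientation} {f = invert} (others C))) (map-cong-local others-orientation))

-- Reduction modulo 2Q into (-Q, Q)

residue-unique : ∀ {q r s} k → -[1+ q ] < r → r < +[1+ q ] → -[1+ q ] < s → s < +[1+ q ] →
                 r ≡ s + + 2 * k * +[1+ q ] → r ≡ s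
residue-unique {q} {r} {s} (+ 0) _ _ _ _ r≡ = trans r≡ (s+0≡s s +[1+ q ])
  where
  s+0≡s : ∀ s Q → s + + 2 * 0ℤ * Q ≡ s
  s+0≡s = solve-∀
residue-unique {q} {_} {s} +[1+ n ] _ r<Q -Q<s _ refl = ⊥-elim (ℤ.<-irrefl (sym (sum≡0 s +[1+ q ] (+ n))) 0<sum)
  where
  0<sum : 0ℤ < (+[1+ q ] - (s + + 2 * +[1+ n ] * +[1+ q ])) + (s + +[1+ q ]) + + 2 * + n * +[1+ q ]
  0<sum = pos+nonNeg⇒pos (pos+pos⇒pos (i<j⇒0<j-i r<Q) (i<j⇒0<j-i -Q<s))
            (nonNeg*nonNeg⇒nonNeg {+ 2 * + n} (nonNeg*nonNeg⇒nonNeg {+ 2} {+ n} (+≤+ z≤n) (+≤+ z≤n)) (+≤+ z≤n))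
  sum≡0 : ∀ s Q t → (Q - (s + + 2 * (1ℤ + t) * Q)) + (s + Q) + + 2 * t * Q ≡ 0ℤ
  sum≡0 = solve-∀
residue-unique {q} {_} {s} -[1+ n ] -Q<r _ _ s<Q refl = ⊥-elim (ℤ.<-irrefl (sym (sum≡0 s +[1+ q ] (+ n))) 0<sum)
  where
  0<sum : 0ℤ < ((s + + 2 * -[1+ n ] * +[1+ q ]) + +[1+ q ]) + (+[1+ q ] - s) + + 2 * + n * +[1+ q ]
  0<sum = pos+nonNeg⇒pos (pos+pos⇒pos (i<j⇒0<j-i -Q<r) (i<j⇒0<j-i s<Q))
            (nonNeg*nonNeg⇒nonNeg {+ 2 * + n} (nonNeg*nonNeg⇒nonNeg {+ 2} {+ n} (+≤+ z≤n) (+≤+ z≤n)) (+≤+ z≤n))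
  sum≡0 : ∀ s Q t → ((s + + 2 * - (1ℤ + t) * Q) + Q) + (Q - s) + + 2 * t * Q ≡ 0ℤ
  sum≡0 = solve-∀

reduce : ℤ → ℕ → ℤ
reduce p q = + ((p + +[1+ q ]) %ℕ (suc q ℕ.+ suc q)) - +[1+ q ]

reduce-congruent : ∀ p q → ∃[ k ] p ≡ reduce p q + + 2 * k * +[1+ q ]
reduce-congruent p q = t , trans (sym (p+Q-Q≡p p +[1+ q ]))
  (trans (cong (_- +[1+ q ]) (a≡a%ℕn+[a/ℕn]*n (p + +[1+ q ]) (suc q ℕ.+ suc q))) (regroup s t +[1+ q ]))
  where
  s t : ℤ
  s = + ((p + +[1+ q ]) %ℕ (suc q ℕ.+ suc q))
  t = (p + +[1+ q ]) /ℕ (suc q ℕ.+ suc q)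
  p+Q-Q≡p : ∀ p Q → p + Q - Q ≡ p
  p+Q-Q≡p = solve-∀
  regroup : ∀ s t Q → s + t * (Q + Q) - Q ≡ s - Q + + 2 * t * Q
  regroup = solve-∀

reduce-bounds : ∀ p q → Oddℤ (p + +[1+ q ]) → -[1+ q ] < reduce p q × reduce p q < +[1+ q ]
reduce-bounds p q odd
  with (p + +[1+ q ]) %ℕ (suc q ℕ.+ suc q) | n%ℕd<d (p + +[1+ q ]) (suc q ℕ.+ suc q)
     | a≡a%ℕn+[a/ℕn]*n (p + +[1+ q ]) (suc q ℕ.+ suc q)
... | 0 | _ | p+Q≡ = contradiction (subst (+ 2 ℤ.∣_) (sym (trans p+Q≡ (even t +[1+ q ]))) (2∣2*k (t * +[1+ q ]))) odd
  where
  t : ℤ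
  t = (p + +[1+ q ]) /ℕ (suc q ℕ.+ suc q)
  even : ∀ t Q → 0ℤ + t * (Q + Q) ≡ + 2 * (t * Q)
  even = solve-∀
... | suc s | s<2Q | _ =
  ℤ.+-monoˡ-< (- +[1+ q ]) (+<+ (s≤s z≤n)) ,
  subst (+[1+ s ] - +[1+ q ] <_) (Q+Q-Q≡Q +[1+ q ]) (ℤ.+-monoˡ-< (- +[1+ q ]) (+<+ s<2Q))
  where
  Q+Q-Q≡Q : ∀ Q → Q + Q - Q ≡ Q
  Q+Q-Q≡Q = solve-∀

reduce-unique : ∀ {p q r} k → Oddℤ (p + +[1+ q ]) → -[1+ q ] < r → r < +[1+ q ] →
                p ≡ r + + 2 * k * +[1+ q ] → reduce p q ≡ r
reduce-unique {p} {q} {r} k odd -Q<r r<Q p≡ with reduce-congruent p q | reduce-bounds p q odd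
... | k₀ , p≡′ | -Q<p′ , p′<Q =
  residue-unique (k - k₀) -Q<p′ p′<Q -Q<r r<Q (difference (reduce p q) r k k₀ +[1+ q ] (trans (sym p≡′) p≡))
  where
  difference : ∀ s r k k₀ Q → s + + 2 * k₀ * Q ≡ r + + 2 * k * Q → s ≡ r + + 2 * (k - k₀) * Q
  difference s r k k₀ Q eq =
    trans (sym (translate-cancel s k₀ Q)) (trans (cong (λ x → x + + 2 * (- k₀) * Q) eq) (regroup r k k₀ Q))
    where
    regroup : ∀ r k k₀ Q → r + + 2 * k * Q + + 2 * (- k₀) * Q ≡ r + + 2 * (k - k₀) * Q
    regroup = solve-∀

reduce-translate : ∀ p q k → Oddℤ (p + +[1+ q ]) → reduce (p + + 2 * k * +[1+ q ]) q ≡ reduce p q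
reduce-translate p q k odd with reduce-congruent p q | reduce-bounds p q odd
... | k₀ , p≡ | -Q<p′ , p′<Q =
  reduce-unique (k₀ + k) (odd-translate p k +[1+ q ] odd) -Q<p′ p′<Q
    (trans (cong (λ x → x + + 2 * k * +[1+ q ]) p≡) (regroup (reduce p q) k k₀ +[1+ q ]))
  where
  regroup : ∀ r k k₀ Q → r + + 2 * k₀ * Q + + 2 * k * Q ≡ r + + 2 * (k₀ + k) * Q
  regroup = solve-∀

reduce-small : ∀ {r q} → Oddℤ (r + +[1+ q ]) → -[1+ q ] < r → r < +[1+ q ] → reduce r q ≡ r
reduce-small {r} {q} odd -Q<r r<Q = reduce-unique 0ℤ odd -Q<r r<Q (sym (r+0≡r r +[1+ q ]))
  where
  r+0≡r : ∀ r Q → r + + 2 * 0ℤ * Q ≡ r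
  r+0≡r = solve-∀

module Descent
  (𝒫 : ℤ → ℕ → Set)
  (zero-case : ∀ q → Oddℤ +[1+ q ] → 𝒫 0ℤ q)
  (translate-case : ∀ p q k → Oddℤ (p + +[1+ q ]) → 𝒫 p q → 𝒫 (p + + 2 * k * +[1+ q ]) q)
  (positive-case : ∀ m q → m ℕ.< q → Oddℤ (+[1+ m ] + +[1+ q ]) → 𝒫 -[1+ q ] m → 𝒫 +[1+ m ] q)
  (negative-case : ∀ m q → m ℕ.< q → Oddℤ (-[1+ m ] + +[1+ q ]) → 𝒫 +[1+ q ] m → 𝒫 -[1+ m ] q)
  where

  descent : ∀ p q → Oddℤ (p + +[1+ q ]) → 𝒫 p q
  descent p q = fuelled (suc q) p q ℕ.≤-refl
    where
    fuelled : ∀ n p q → q ℕ.< n → Oddℤ (p + +[1+ q ]) → 𝒫 p q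
    reduced : ∀ n r q → q ℕ.≤ n → -[1+ q ] < r → r < +[1+ q ] → Oddℤ (r + +[1+ q ]) → 𝒫 r q
    fuelled (suc n) p q (s≤s q≤n) odd with reduce-congruent p q | reduce-bounds p q odd
    ... | k , p≡ | -Q<r , r<Q =
      subst (λ p′ → 𝒫 p′ q) (sym p≡)
            (translate-case (reduce p q) q k odd-r (reduced n (reduce p q) q q≤n -Q<r r<Q odd-r))
      where
      odd-r : Oddℤ (reduce p q + +[1+ q ])
      odd-r = subst (λ p′ → Oddℤ (p′ + +[1+ q ])) (trans (cong (λ x → x + + 2 * (- k) * +[1+ q ]) p≡)
                                                      (translate-cancel (reduce p q) k +[1+ q ]))
                (odd-translate p (- k) +[1+ q ] odd)
    reduced n (+ 0) q _ _ _ odd = zero-case q odd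
    reduced n +[1+ m ] q q≤n _ (+<+ (s≤s m<q)) odd =
      positive-case m q m<q odd (fuelled n -[1+ q ] m (ℕ.<-≤-trans m<q q≤n)
        (odd-invert⁺ m q odd))
    reduced n -[1+ m ] q q≤n (-<- m<q) _ odd =
      negative-case m q m<q odd (fuelled n +[1+ q ] m (ℕ.<-≤-trans m<q q≤n)
        (odd-invert⁻ m q odd))

open Descent using (descent)

-- I-fuel n p q is I_θ(p / (1 + q)) as soon as q < n: shift p/(1+q) by an even integer
-- into (-1, 1) and, unless it is 0, use I_θ(x) = sign x + I_θ(-1/x), whose denominator is smaller.
I-fuel    : ℕ → ℤ → ℕ → ℤ
I-reduced : ℕ → ℤ → ℕ → ℤ
I-fuel zero    p q = 0ℤ
I-fuel (suc n) p q = I-reduced n (reduce p q) q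
I-reduced n (+ 0)    q = 0ℤ
I-reduced n +[1+ m ] q = 1ℤ + I-fuel n -[1+ q ] m
I-reduced n -[1+ m ] q = - 1ℤ + I-fuel n +[1+ q ] m

I : ℤ → ℕ → ℤ
I p q = I-fuel (suc q) p q

I-fuel-translate : ∀ n p q k → Oddℤ (p + +[1+ q ]) → I-fuel n (p + + 2 * k * +[1+ q ]) q ≡ I-fuel n p q
I-fuel-translate zero    p q k odd = refl
I-fuel-translate (suc n) p q k odd = cong (λ r → I-reduced n r q) (reduce-translate p q k odd)

I-fuel-reduced : ∀ n {r q} → Oddℤ (r + +[1+ q ]) → -[1+ q ] < r → r < +[1+ q ] → I-fuel (suc n) r q ≡ I-reduced n r q
I-fuel-reduced n {q = q} odd -Q<r r<Q = cong (λ r → I-reduced n r q) (reduce-small odd -Q<r r<Q)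

I-fuel-stable : ∀ p q → Oddℤ (p + +[1+ q ]) → ∀ n → q ℕ.< n → I-fuel n p q ≡ I p q
I-fuel-stable =
  descent (λ p q → ∀ n → q ℕ.< n → I-fuel n p q ≡ I p q) zero-case translate-case positive-case negative-case
  where
  zero-case : ∀ q → Oddℤ +[1+ q ] → ∀ n → q ℕ.< n → I-fuel n 0ℤ q ≡ I 0ℤ q
  zero-case q odd (suc n) _ =
    trans (I-fuel-reduced n odd -<+ (+<+ (s≤s z≤n))) (sym (I-fuel-reduced q odd -<+ (+<+ (s≤s z≤n))))
  translate-case : ∀ p q k → Oddℤ (p + +[1+ q ]) → (∀ n → q ℕ.< n → I-fuel n p q ≡ I p q) →
                   ∀ n → q ℕ.< n → I-fuel n (p + + 2 * k * +[1+ q ]) q ≡ I (p + + 2 * k * +[1+ q ]) q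
  translate-case p q k odd stable n q<n =
    trans (I-fuel-translate n p q k odd) (trans (stable n q<n) (sym (I-fuel-translate (suc q) p q k odd)))
  positive-case : ∀ m q → m ℕ.< q → Oddℤ (+[1+ m ] + +[1+ q ]) → (∀ n → m ℕ.< n → I-fuel n -[1+ q ] m ≡ I -[1+ q ] m) →
                  ∀ n → q ℕ.< n → I-fuel n +[1+ m ] q ≡ I +[1+ m ] q
  positive-case m q m<q odd stable (suc n) (s≤s q≤n) =
    trans (I-fuel-reduced n odd -<+ (+<+ (s≤s m<q)))
      (trans (cong (_+_ 1ℤ) (trans (stable n (ℕ.<-≤-trans m<q q≤n)) (sym (stable q m<q))))
             (sym (I-fuel-reduced q odd -<+ (+<+ (s≤s m<q)))))
  negative-case : ∀ m q → m ℕ.< q → Oddℤ (-[1+ m ] + +[1+ q ]) → (∀ n → m ℕ.< n → I-fuel n +[1+ q ] m ≡ I +[1+ q ] m) →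
                  ∀ n → q ℕ.< n → I-fuel n -[1+ m ] q ≡ I -[1+ m ] q
  negative-case m q m<q odd stable (suc n) (s≤s q≤n) =
    trans (I-fuel-reduced n odd (-<- m<q) -<+)
      (trans (cong (_+_ (- 1ℤ)) (trans (stable n (ℕ.<-≤-trans m<q q≤n)) (sym (stable q m<q))))
             (sym (I-fuel-reduced q odd (-<- m<q) -<+)))

I-zero : ∀ {q} → Oddℤ +[1+ q ] → I 0ℤ q ≡ 0ℤ
I-zero {q} odd = I-fuel-reduced q odd -<+ (+<+ (s≤s z≤n))

I-translate : ∀ p q k → Oddℤ (p + +[1+ q ]) → I (p + + 2 * k * +[1+ q ]) q ≡ I p q
I-translate p q = I-fuel-translate (suc q) p q

I-positive : ∀ {m q} → m ℕ.< q → Oddℤ (+[1+ m ] + +[1+ q ]) → I +[1+ m ] q ≡ 1ℤ + I -[1+ q ] m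
I-positive {m} {q} m<q odd = trans (I-fuel-reduced q odd -<+ (+<+ (s≤s m<q)))
  (cong (_+_ 1ℤ) (I-fuel-stable -[1+ q ] m (odd-invert⁺ m q odd) q m<q))

I-negative : ∀ {m q} → m ℕ.< q → Oddℤ (-[1+ m ] + +[1+ q ]) → I -[1+ m ] q ≡ - 1ℤ + I +[1+ q ] m
I-negative {m} {q} m<q odd = trans (I-fuel-reduced q odd (-<- m<q) -<+)
  (cong (_+_ (- 1ℤ)) (I-fuel-stable +[1+ q ] m (odd-invert⁻ m q odd) q m<q))

I-neg : ∀ p q → Oddℤ (p + +[1+ q ]) → I (- p) q ≡ - I p q
I-neg = descent (λ p q → I (- p) q ≡ - I p q) zero-case translate-case positive-case negative-case
  where
  open ≡-Reasoning
  zero-case : ∀ q → Oddℤ +[1+ q ] → I 0ℤ q ≡ - I 0ℤ q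
  zero-case _ odd = trans (I-zero odd) (cong -_ (sym (I-zero odd)))
  translate-case : ∀ p q k → Oddℤ (p + +[1+ q ]) → I (- p) q ≡ - I p q →
                   I (- (p + + 2 * k * +[1+ q ])) q ≡ - I (p + + 2 * k * +[1+ q ]) q
  translate-case p q k odd I-neg-p = begin
    I (- (p + + 2 * k * +[1+ q ])) q    ≡⟨ cong (λ x → I x q) (neg-translate p k +[1+ q ]) ⟩
    I (- p + + 2 * - k * +[1+ q ]) q    ≡⟨ I-translate (- p) q (- k) (odd-negate p +[1+ q ] odd) ⟩
    I (- p) q                           ≡⟨ I-neg-p ⟩
    - I p q                             ≡⟨ cong -_ (sym (I-translate p q k odd)) ⟩
    - I (p + + 2 * k * +[1+ q ]) q      ∎
    where
    neg-translate : ∀ p k Q → - (p + + 2 * k * Q) ≡ - p + + 2 * - k * Q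
    neg-translate = solve-∀
  positive-case : ∀ m q → m ℕ.< q → Oddℤ (+[1+ m ] + +[1+ q ]) →
                  I +[1+ q ] m ≡ - I -[1+ q ] m → I -[1+ m ] q ≡ - I +[1+ m ] q
  positive-case m q m<q odd I-neg-Q = begin
    I -[1+ m ] q                ≡⟨ I-negative m<q (odd-negate +[1+ m ] +[1+ q ] odd) ⟩
    - 1ℤ + I +[1+ q ] m         ≡⟨ cong (_+_ (- 1ℤ)) I-neg-Q ⟩
    - 1ℤ + - I -[1+ q ] m       ≡⟨ ℤ.neg-distrib-+ 1ℤ (I -[1+ q ] m) ⟨
    - (1ℤ + I -[1+ q ] m)       ≡⟨ cong -_ (I-positive m<q odd) ⟨
    - I +[1+ m ] q              ∎
  negative-case : ∀ m q → m ℕ.< q → Oddℤ (-[1+ m ] + +[1+ q ]) →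
                  I -[1+ q ] m ≡ - I +[1+ q ] m → I +[1+ m ] q ≡ - I -[1+ m ] q
  negative-case m q m<q odd I-neg-Q = begin
    I +[1+ m ] q                ≡⟨ I-positive m<q (odd-negate -[1+ m ] +[1+ q ] odd) ⟩
    1ℤ + I -[1+ q ] m           ≡⟨ cong (_+_ 1ℤ) I-neg-Q ⟩
    1ℤ + - I +[1+ q ] m         ≡⟨ ℤ.neg-distrib-+ (- 1ℤ) (I +[1+ q ] m) ⟨
    - (- 1ℤ + I +[1+ q ] m)     ≡⟨ cong -_ (I-negative m<q odd) ⟨
    - I -[1+ m ] q              ∎

I-reciprocal-< : ∀ {m q} → m ℕ.< q → Oddℤ (+[1+ m ] + +[1+ q ]) → I +[1+ m ] q + I +[1+ q ] m ≡ 1ℤ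
I-reciprocal-< {m} {q} m<q odd =
  trans (cong₂ _+_ (I-positive m<q odd) (I-neg -[1+ q ] m (odd-invert⁺ m q odd))) (cancel (I -[1+ q ] m))
  where
  cancel : ∀ x → (1ℤ + x) + - x ≡ 1ℤ
  cancel = solve-∀

I-reciprocal : ∀ m q → Oddℤ (+[1+ m ] + +[1+ q ]) → I +[1+ m ] q + I +[1+ q ] m ≡ 1ℤ
I-reciprocal m q odd with ℕ.<-cmp m q
... | tri< m<q _ _  = I-reciprocal-< m<q odd
... | tri≈ _ refl _ = contradiction odd (¬odd[i+i] +[1+ m ])
... | tri> _ _ q<m  = trans (ℤ.+-comm (I +[1+ m ] q) (I +[1+ q ] m))
                            (I-reciprocal-< q<m (odd-+-comm +[1+ m ] +[1+ q ] odd))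

-- I_θ is the sum over the net

crossings : ∀ p q → Oddℤ (p + +[1+ q ]) → Crossings p q (I p q)
crossings = descent (λ p q → Crossings p q (I p q)) zero-case translate-case positive-case negative-case
  where
  zero-case : ∀ q → Oddℤ +[1+ q ] → Crossings 0ℤ q (I 0ℤ q)
  zero-case q odd = subst (Crossings 0ℤ q) (sym (I-zero odd)) (crossings-zero q)
  translate-case : ∀ p q k → Oddℤ (p + +[1+ q ]) → Crossings p q (I p q) →
                   Crossings (p + + 2 * k * +[1+ q ]) q (I (p + + 2 * k * +[1+ q ]) q)
  translate-case p q k odd C = subst (Crossings _ q) (sym (I-translate p q k odd)) (crossings-translate k C)
  positive-case : ∀ m q → m ℕ.< q → Oddℤ (+[1+ m ] + +[1+ q ]) →
                  Crossings -[1+ q ] m (I -[1+ q ] m) → Crossings +[1+ m ] q (I +[1+ m ] q)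
  positive-case m q m<q odd C = subst (Crossings _ q) (sym (I-positive m<q odd)) (crossings-invert m<q C)
  negative-case : ∀ m q → m ℕ.< q → Oddℤ (-[1+ m ] + +[1+ q ]) →
                  Crossings +[1+ q ] m (I +[1+ q ] m) → Crossings -[1+ m ] q (I -[1+ m ] q)
  negative-case m q m<q odd C =
    subst (Crossings _ q) (trans (regroup (I +[1+ q ] m)) (sym (I-negative m<q odd)))
      (crossings-reflect (crossings-invert m<q (crossings-reflect C)))
    where
    regroup : ∀ x → - (1ℤ + - x) ≡ - 1ℤ + x
    regroup = solve-∀

Iθ : ℚ → ℤ
Iθ x = I (↥ x) (ℚ.denominator-1 x)

Iθ-sum : ∀ x → Qθ x → IθSum x (Iθ x)
Iθ-sum x qθ =
  top C ∷ others C , unique C , inNet C ,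
  (λ g net φ≢0 → complete C g net (φ≢0⇒Crosses g x φ≢0)) ,
  trans (cong sumℤ (map-cong-local (All.map (λ {g} → φ≡orientation g x) (crossing C)))) (sum C)
  where
  C : Crossings (↥ x) (ℚ.denominator-1 x) (Iθ x)
  C = crossings (↥ x) (ℚ.denominator-1 x) qθ

mkℚ-cong : ∀ {p p′ q} .{c : Coprime ℤ.∣ p ∣ (suc q)} .{c′ : Coprime ℤ.∣ p′ ∣ (suc q)} →
           p ≡ p′ → mkℚ p q c ≡ mkℚ p′ q c′
mkℚ-cong refl = refl

mkℚ0≡0ℚ : ∀ {q} .(c : Coprime 0 (suc q)) → mkℚ (+ 0) q c ≡ 0ℚ
mkℚ0≡0ℚ c with ℕ.suc-injective (0-coprimeTo-m⇒m≡1 (Coprime.recompute c))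
... | refl = refl

mkℚ+1+1 : ∀ p q .(c : Coprime ℤ.∣ p ∣ (suc q)) →
          mkℚ p q c ℚ.+ 1ℚ ℚ.+ 1ℚ ≡ mkℚ (p + + 2 * 1ℤ * +[1+ q ]) q (coprime-+-* p q (+ 2 * 1ℤ) c)
mkℚ+1+1 p q c = ℚ.toℚᵘ-injective
  (ℚᵘ.≃-trans (ℚ.toℚᵘ-homo-+ (mkℚ p q c ℚ.+ 1ℚ) 1ℚ)
  (ℚᵘ.≃-trans (ℚᵘ.+-congˡ (toℚᵘ 1ℚ) (ℚ.toℚᵘ-homo-+ (mkℚ p q c) 1ℚ))
              (ℚᵘ.*≡* (cross-multiplied p +[1+ q ]))))
  where
  cross-multiplied : ∀ p Q → ((p * 1ℤ + 1ℤ * Q) * 1ℤ + 1ℤ * (Q * 1ℤ)) * Q ≡ (p + + 2 * 1ℤ * Q) * ((Q * 1ℤ) * 1ℤ)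
  cross-multiplied = solve-∀

Iθ-neg : ∀ x → Qθ x → Iθ (ℚ.- x) ≡ - Iθ x
Iθ-neg (mkℚ +[1+ n ] q _) = I-neg +[1+ n ] q
Iθ-neg (mkℚ (+ 0)    q _) = I-neg 0ℤ q
Iθ-neg (mkℚ -[1+ n ] q _) = I-neg -[1+ n ] q

Iθ-+2 : ∀ x → Qθ x → Iθ (x ℚ.+ 1ℚ ℚ.+ 1ℚ) ≡ Iθ x
Iθ-+2 (mkℚ p q c) qθ = trans (cong Iθ (mkℚ+1+1 p q c)) (I-translate p q 1ℤ qθ)

Iθ-reciprocal : ∀ x → Qθ x → (x≢0 : x ≢ 0ℚ) → Iθ x + Iθ (ℚ.1/_ x {{ℚ.≢-nonZero x≢0}}) ≡ sgn x
Iθ-reciprocal (mkℚ +[1+ n ] q _) qθ _   = I-reciprocal n q qθ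
Iθ-reciprocal (mkℚ (+ 0)    q c) _  x≢0 = contradiction (mkℚ0≡0ℚ c) x≢0
Iθ-reciprocal (mkℚ -[1+ n ] q _) qθ _   = begin
  I -[1+ n ] q + I -[1+ q ] n         ≡⟨ cong₂ _+_ (I-neg +[1+ n ] q odd) (I-neg +[1+ q ] n (odd-+-comm +[1+ n ] +[1+ q ] odd)) ⟩
  - I +[1+ n ] q + - I +[1+ q ] n     ≡⟨ ℤ.neg-distrib-+ (I +[1+ n ] q) (I +[1+ q ] n) ⟨
  - (I +[1+ n ] q + I +[1+ q ] n)     ≡⟨ cong -_ (I-reciprocal n q odd) ⟩
  - 1ℤ                                ∎
  where
  open ≡-Reasoning
  odd : Oddℤ (+[1+ n ] + +[1+ q ])
  odd = odd-negate -[1+ n ] +[1+ q ] qθ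

Iθ-Props : Props Iθ
Iθ-Props = Iθ-neg , Iθ-+2 , Iθ-reciprocal

-- Uniqueness

module Uniqueness (f : ℚ → ℤ) (f-props : Props f) where

  f-neg : ∀ x → Qθ x → f (ℚ.- x) ≡ - f x
  f-neg = proj₁ f-props

  f-+2 : ∀ x → Qθ x → f (x ℚ.+ 1ℚ ℚ.+ 1ℚ) ≡ f x
  f-+2 = proj₁ (proj₂ f-props)

  f-reciprocal : ∀ x → Qθ x → (x≢0 : x ≢ 0ℚ) → f x + f (ℚ.1/_ x {{ℚ.≢-nonZero x≢0}}) ≡ sgn x
  f-reciprocal = proj₂ (proj₂ f-props)

  f-translate-ℕ : ∀ n p q .(c : Coprime ℤ.∣ p + + 2 * + n * +[1+ q ] ∣ (suc q)) .(c′ : Coprime ℤ.∣ p ∣ (suc q)) →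
                  Oddℤ (p + +[1+ q ]) → f (mkℚ (p + + 2 * + n * +[1+ q ]) q c) ≡ f (mkℚ p q c′)
  f-translate-ℕ zero    p q c c′ odd = cong f (mkℚ-cong (p+0≡p p +[1+ q ]))
    where
    p+0≡p : ∀ p Q → p + + 2 * 0ℤ * Q ≡ p
    p+0≡p = solve-∀
  f-translate-ℕ (suc n) p q c c′ odd = begin
    f (mkℚ (p + + 2 * +[1+ n ] * +[1+ q ]) q c)
      ≡⟨ cong f (mkℚ-cong (step p (+ n) +[1+ q ])) ⟩
    f (mkℚ (p + + 2 * + n * +[1+ q ] + + 2 * 1ℤ * +[1+ q ]) q _)
      ≡⟨ cong f (mkℚ+1+1 (p + + 2 * + n * +[1+ q ]) q (coprime-+-* p q (+ 2 * + n) c′)) ⟨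
    f (mkℚ (p + + 2 * + n * +[1+ q ]) q (coprime-+-* p q (+ 2 * + n) c′) ℚ.+ 1ℚ ℚ.+ 1ℚ)
      ≡⟨ f-+2 _ (odd-translate p (+ n) +[1+ q ] odd) ⟩
    f (mkℚ (p + + 2 * + n * +[1+ q ]) q (coprime-+-* p q (+ 2 * + n) c′))
      ≡⟨ f-translate-ℕ n p q (coprime-+-* p q (+ 2 * + n) c′) c′ odd ⟩
    f (mkℚ p q c′) ∎
    where
    open ≡-Reasoning
    step : ∀ p t Q → p + + 2 * (1ℤ + t) * Q ≡ p + + 2 * t * Q + + 2 * 1ℤ * Q
    step = solve-∀

  f-translate : ∀ k p q .(c : Coprime ℤ.∣ p + + 2 * k * +[1+ q ] ∣ (suc q)) .(c′ : Coprime ℤ.∣ p ∣ (suc q)) →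
                Oddℤ (p + +[1+ q ]) → f (mkℚ (p + + 2 * k * +[1+ q ]) q c) ≡ f (mkℚ p q c′)
  f-translate (+ n)    p q c c′ odd = f-translate-ℕ n p q c c′ odd
  f-translate -[1+ n ] p q c c′ odd =
    trans (sym (f-translate-ℕ (suc n) p′ q (subst (λ z → Coprime ℤ.∣ z ∣ (suc q)) (sym p′+2[1+n]Q≡p) c′) c
                 (odd-translate p -[1+ n ] +[1+ q ] odd)))
          (cong f (mkℚ-cong p′+2[1+n]Q≡p))
    where
    p′ : ℤ
    p′ = p + + 2 * -[1+ n ] * +[1+ q ]
    p′+2[1+n]Q≡p : p′ + + 2 * +[1+ n ] * +[1+ q ] ≡ p
    p′+2[1+n]Q≡p = translate-cancel p -[1+ n ] +[1+ q ]

  𝒫 : ℤ → ℕ → Set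
  𝒫 p q = .(c : Coprime ℤ.∣ p ∣ (suc q)) → f (mkℚ p q c) ≡ I p q

  f≡I-zero : ∀ q → Oddℤ +[1+ q ] → 𝒫 0ℤ q
  f≡I-zero q odd c = trans (i≡-i⇒i≡0 (f-neg (mkℚ (+ 0) q c) odd)) (sym (I-zero odd))

  f≡I-translate : ∀ p q k → Oddℤ (p + +[1+ q ]) → 𝒫 p q → 𝒫 (p + + 2 * k * +[1+ q ]) q
  f≡I-translate p q k odd f≡I-p c =
    trans (f-translate k p q c (coprime-untranslate p q k c) odd)
          (trans (f≡I-p (coprime-untranslate p q k c)) (sym (I-translate p q k odd)))

  f≡I-positive : ∀ m q → m ℕ.< q → Oddℤ (+[1+ m ] + +[1+ q ]) → 𝒫 -[1+ q ] m → 𝒫 +[1+ m ] q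
  f≡I-positive m q m<q odd f≡I-−Q c = begin
    f (mkℚ +[1+ m ] q c)              ≡⟨ a+b≡c⇒a≡c-b (f-reciprocal (mkℚ +[1+ m ] q c) odd (λ ())) ⟩
    1ℤ - f (mkℚ +[1+ q ] m _)         ≡⟨ cong (_+_ 1ℤ) (f-neg (mkℚ +[1+ q ] m (Coprime.sym c)) (odd-+-comm +[1+ m ] +[1+ q ] odd)) ⟨
    1ℤ + f (mkℚ -[1+ q ] m _)         ≡⟨ cong (_+_ 1ℤ) (f≡I-−Q (Coprime.sym c)) ⟩
    1ℤ + I -[1+ q ] m                 ≡⟨ I-positive m<q odd ⟨
    I +[1+ m ] q                      ∎
    where open ≡-Reasoning

  f≡I-negative : ∀ m q → m ℕ.< q → Oddℤ (-[1+ m ] + +[1+ q ]) → 𝒫 +[1+ q ] m → 𝒫 -[1+ m ] q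
  f≡I-negative m q m<q odd f≡I-Q c = begin
    f (mkℚ -[1+ m ] q c)              ≡⟨ a+b≡c⇒a≡c-b (f-reciprocal (mkℚ -[1+ m ] q c) odd (λ ())) ⟩
    - 1ℤ - f (mkℚ -[1+ q ] m _)       ≡⟨ cong (λ t → - 1ℤ - t) (f-neg (mkℚ +[1+ q ] m (Coprime.sym c)) (odd-invert⁻ m q odd)) ⟩
    - 1ℤ - - f (mkℚ +[1+ q ] m _)     ≡⟨ cong (_+_ (- 1ℤ)) (ℤ.neg-involutive (f (mkℚ +[1+ q ] m (Coprime.sym c)))) ⟩
    - 1ℤ + f (mkℚ +[1+ q ] m _)       ≡⟨ cong (_+_ (- 1ℤ)) (f≡I-Q (Coprime.sym c)) ⟩
    - 1ℤ + I +[1+ q ] m               ≡⟨ I-negative m<q odd ⟨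
    I -[1+ m ] q                      ∎
    where open ≡-Reasoning

  f≡Iθ : ∀ x → Qθ x → f x ≡ Iθ x
  f≡Iθ (mkℚ p q c) qθ = descent 𝒫 f≡I-zero f≡I-translate f≡I-positive f≡I-negative p q qθ c

theorem5 : Σ (ℚ → ℤ) λ I →
    (∀ x → Qθ x → IθSum x (I x)) ×
    Props I ×
    (∀ f → Props f → ∀ x → Qθ x → f x ≡ I x)
theorem5 = Iθ , Iθ-sum , Iθ-Props , Uniqueness.f≡Iθ
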